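{- Let $p$ be a prime. Then $\max_{s\in(\mathbb{Z}/p\mathbb{Z})\setminus\{0\}} r(s)$ is greater than or equal to the largest positive integer $k$ such that \[ (k-2)4^{k}-(k-4)2^{k}\le 2p . \]
   Context: Let $S$ be the smallest set of formal expressions (terms built from the symbol $x$ with $+$, $\cdot$ and parentheses) such that $x\in S$ and, whenever $E\in S$, also $(E)+x\in S$ and $(E)\cdot x\in S$ (modified complexity expressions); the modified complexity of an element of $S$ is its number of occurrences of $x$. For a nonzero $s\in\mathbb{Z}/p\mathbb{Z}$, the resilience $r(s)$ is the least positive integer $k$ such that there exist two distinct expressions $f,g\in S$, each of modified complexity at most $k$, with $f(s)=g(s)$ in $\mathbb{Z}/p\mathbb{Z}$. -}

module Defs where

open import Data.Nat as ℕ using (ℕ; zero; suc; _≤_; _<_)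
open import Data.Integer as ℤ using (ℤ; +_)
open import Data.Integer.Divisibility as ℤDiv using ()
open import Data.Product using (Σ; _×_; ∃-syntax)
open import Relation.Binary.PropositionalEquality using (_≡_; _≢_)
open import Relation.Nullary using (¬_)

data Expr : Set where
  x    : Expr
  _+x : Expr → Expr
  _·x : Expr → Expr

complexity : Expr → ℕ
complexity x      = 1
complexity (e +x) = suc (complexity e)
complexity (e ·x) = suc (complexity e)

-- evaluation at s (over ℕ; compared modulo p afterwards)
eval : ℕ → Expr → ℕ
eval s x      = s
eval s (e +x) = eval s e ℕ.+ s
eval s (e ·x) = eval s e ℕ.* s

_≡_[mod_] : ℕ → ℕ → ℕ → Set
a ≡ b [mod p ] = (+ p) ℤDiv.∣ ((+ a) ℤ.- (+ b))

Collides : ℕ → ℕ → ℕ → Set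
Collides p s k = Σ Expr λ f → Σ Expr λ g →
  f ≢ g × complexity f ≤ k × complexity g ≤ k × eval s f ≡ eval s g [mod p ]

-- r is the resilience r(s) of s in ℤ/pℤ: least positive k with a collision
IsResilience : ℕ → ℕ → ℕ → Set
IsResilience p s r = 1 ≤ r × Collides p s r × (∀ k → 1 ≤ k → k < r → ¬ Collides p s k)

Bound : ℕ → ℕ → Set
Bound p k = ((+ k ℤ.- + 2) ℤ.* (+ (4 ℕ.^ k))) ℤ.- ((+ k ℤ.- + 4) ℤ.* (+ (2 ℕ.^ k))) ℤ.≤ + (2 ℕ.* p)

IsLargestBound : ℕ → ℕ → Set
IsLargestBound p K = 1 ≤ K × Bound p K × (∀ k → K < k → ¬ Bound p k)

{-# OPTIONS --safe #-}

-- An expression of complexity at most k computes a polynomial with coefficients in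
-- {0, …, k} and no constant term, and distinct expressions compute distinct polynomials.
-- For k < p two distinct such expressions thus differ, modulo p, by a nonzero polynomial
-- of degree at most k vanishing at 0, which by Lagrange's theorem has at most k - 1
-- nonzero roots.  There are fewer than 2^k expressions of complexity at most k, so fewer
-- than 4^k (k - 1) triples (f, g, s) with f ≢ g and f(s) ≡ g(s); the condition on
-- K = k + 1 makes this smaller than p - 1, so some nonzero residue s has no collision
-- of complexity k, i.e. r(s) ≥ K.
module Submission where

open import Defs
open import Data.Nat using (ℕ; _≤_; _<_)
open import Data.Nat.Primality using (Prime)
open import Data.Product using (Σ; _×_)

open import Data.Nat.Base as ℕ
  using (zero; suc; 2+; _+_; _*_; _^_; ∣_-_∣; z≤n; s≤s; s≤s⁻¹; s<s⁻¹)
import Data.Nat.Properties as ℕₚ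
import Data.Nat.Divisibility as ℕᵈ
open import Data.Nat.ListAction using (sum)
open import Data.Nat.Primality using (euclidsLemma; prime⇒nonTrivial)
import Data.Nat.Tactic.RingSolver as ℕRing
open import Data.Integer.Base as ℤ using (ℤ; +_; 0ℤ)
import Data.Integer.Properties as ℤₚ
open import Data.Integer.Divisibility using (_∣_)
open import Data.Integer.Divisibility.Signed as Signed using (∣ᵤ⇒∣; ∣⇒∣ᵤ)
import Data.Integer.Tactic.RingSolver as ℤRing
open import Data.List.Base using (List; []; _∷_; length; map; _++_; filter; applyUpTo; cartesianProduct)
open import Data.List.Properties using (length-map; length-++; length-applyUpTo; filter-accept)
open import Data.List.Membership.Propositional using (_∈_; find; lose)
open import Data.List.Membership.Propositional.Properties
  using (∈-map⁺; ∈-++⁺ˡ; ∈-++⁺ʳ; ∈-applyUpTo⁺; ∈-cartesianProduct⁺; ∈-cartesianProduct⁻)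
open import Data.List.Relation.Unary.All as All using (All; []; _∷_)
import Data.List.Relation.Unary.All.Properties as All
open import Data.List.Relation.Unary.Any as Any using (Any; here; there; any?)
open import Data.List.Relation.Unary.AllPairs using (AllPairs; []; _∷_)
import Data.List.Relation.Unary.AllPairs.Properties as AllPairs
open import Data.List.Relation.Unary.Unique.Propositional using (Unique)
import Data.List.Relation.Unary.Unique.Propositional.Properties as Unique
open import Data.Product using (_,_; proj₁; proj₂; ∃-syntax)
open import Data.Bool using (true; false)
open import Data.Sum using (_⊎_; [_,_]′)
open import Data.Empty using (⊥-elim)
open import Function using (_∘_; id)
open import Relation.Binary.Definitions using (DecidableEquality)
open import Relation.Binary.PropositionalEquality
open import Relation.Nullary using (¬_; Dec; yes; no; does; contradiction; ¬?)
open import Relation.Nullary.Decidable using (_×-dec_; map′)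
open import Relation.Unary using (Decidable)

-- Polynomials over ℤ, as coefficient lists in increasing degree

horner : List ℤ → ℤ → ℤ
horner []       _ = 0ℤ
horner (c ∷ cs) a = c ℤ.+ a ℤ.* horner cs a

-- Synthetic division of a polynomial by (y - a), discarding the remainder.
deflate : ℤ → List ℤ → List ℤ
deflate a []           = []
deflate a (_ ∷ [])     = []
deflate a (_ ∷ c ∷ cs) = horner (c ∷ cs) a ∷ deflate a (c ∷ cs)

length-deflate : ∀ a c cs → length (deflate a (c ∷ cs)) ≡ length cs
length-deflate a c []        = refl
length-deflate a c (c′ ∷ cs) = cong suc (length-deflate a c′ cs)

horner-deflate : ∀ a y cs → horner cs y ≡ (y ℤ.- a) ℤ.* horner (deflate a cs) y ℤ.+ horner cs a
horner-deflate a y []            = identity y a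
  where identity : ∀ y a → 0ℤ ≡ (y ℤ.- a) ℤ.* 0ℤ ℤ.+ 0ℤ
        identity = ℤRing.solve-∀
horner-deflate a y (c ∷ [])      = identity c y a
  where identity : ∀ c y a → c ℤ.+ y ℤ.* 0ℤ ≡ (y ℤ.- a) ℤ.* 0ℤ ℤ.+ (c ℤ.+ a ℤ.* 0ℤ)
        identity = ℤRing.solve-∀
horner-deflate a y (c ∷ c′ ∷ cs) rewrite horner-deflate a y (c′ ∷ cs) =
  identity c y a (horner (deflate a (c′ ∷ cs)) y) (horner (c′ ∷ cs) a)
  where identity : ∀ c y a q r → c ℤ.+ y ℤ.* ((y ℤ.- a) ℤ.* q ℤ.+ r)
                                  ≡ (y ℤ.- a) ℤ.* (r ℤ.+ y ℤ.* q) ℤ.+ (c ℤ.+ a ℤ.* r)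
        identity = ℤRing.solve-∀

-- Divisibility is the unsigned one of `_≡_[mod_]`; its additive laws come from the signed one.
module _ {p : ℕ} where

  ∣m+n∣n⇒∣m : ∀ i j → + p ∣ i ℤ.+ j → + p ∣ j → + p ∣ i
  ∣m+n∣n⇒∣m i j p∣i+j p∣j =
    ∣⇒∣ᵤ (Signed.∣m+n∣n⇒∣m {+ p} {i} {j} (∣ᵤ⇒∣ p∣i+j) (∣ᵤ⇒∣ p∣j))

  ∣n⇒∣m*n : ∀ i j → + p ∣ j → + p ∣ i ℤ.* j
  ∣n⇒∣m*n i j p∣j = ∣⇒∣ᵤ (Signed.∣n⇒∣m*n {+ p} i {j} (∣ᵤ⇒∣ p∣j))

  deflate-∣⁻ : ∀ a cs → All (+ p ∣_) (deflate a cs) → + p ∣ horner cs a → All (+ p ∣_) cs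
  deflate-∣⁻ a []            _                 _      = []
  deflate-∣⁻ a (c ∷ [])      _                 p∣P[a] = subst (+ p ∣_) c+a*0≡c p∣P[a] ∷ []
    where c+a*0≡c : c ℤ.+ a ℤ.* 0ℤ ≡ c
          c+a*0≡c = trans (cong (λ z → c ℤ.+ z) (ℤₚ.*-zeroʳ a)) (ℤₚ.+-identityʳ c)
  deflate-∣⁻ a (c ∷ c′ ∷ cs) (p∣P′[a] ∷ p∣Q) p∣P[a] =
    p∣c ∷ deflate-∣⁻ a (c′ ∷ cs) p∣Q p∣P′[a]
    where p∣c : + p ∣ c
          p∣c = ∣m+n∣n⇒∣m c _ p∣P[a] (∣n⇒∣m*n a _ p∣P′[a])

  prime-∣-* : Prime p → ∀ i j → + p ∣ i ℤ.* j → + p ∣ i ⊎ + p ∣ j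
  prime-∣-* pr i j p∣ij = euclidsLemma ℤ.∣ i ∣ ℤ.∣ j ∣ pr (subst (p ℕᵈ.∣_) (ℤₚ.abs-* i j) p∣ij)

  deflate-root : Prime p → ∀ a b cs → + p ∣ horner cs a → + p ∣ horner cs b → ¬ + p ∣ b ℤ.- a →
                 + p ∣ horner (deflate a cs) b
  deflate-root pr a b cs p∣P[a] p∣P[b] p∤b-a =
    [ (λ p∣b-a → contradiction p∣b-a p∤b-a) , id ]′ (prime-∣-* pr (b ℤ.- a) Q[b] p∣[b-a]Q[b])
    where
    Q[b] : ℤ
    Q[b] = horner (deflate a cs) b
    p∣[b-a]Q[b] : + p ∣ (b ℤ.- a) ℤ.* Q[b]
    p∣[b-a]Q[b] = ∣m+n∣n⇒∣m ((b ℤ.- a) ℤ.* Q[b]) (horner cs a)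
                            (subst (+ p ∣_) (horner-deflate a b cs) p∣P[b]) p∣P[a]

  roots⇒∣-coefficients : Prime p → ∀ cs rs → AllPairs (λ a b → ¬ + p ∣ b ℤ.- a) rs →
                         All (λ r → + p ∣ horner cs r) rs → length cs ≤ length rs → All (+ p ∣_) cs
  roots⇒∣-coefficients pr []       rs       _                 _                   _         = []
  roots⇒∣-coefficients pr (c ∷ cs) []       _                 _                   ()
  roots⇒∣-coefficients pr (c ∷ cs) (a ∷ rs) (a≢rs ∷ distinct) (p∣P[a] ∷ p∣P[rs]) (s≤s len) =
    deflate-∣⁻ a (c ∷ cs) (roots⇒∣-coefficients pr (deflate a (c ∷ cs)) rs distinct p∣Q[rs] len′) p∣P[a]
    where
    p∣Q[rs] : All (λ r → + p ∣ horner (deflate a (c ∷ cs)) r) rs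
    p∣Q[rs] = All.zipWith (λ (p∣P[b] , p∤b-a) → deflate-root pr a _ (c ∷ cs) p∣P[a] p∣P[b] p∤b-a)
                          (p∣P[rs] , a≢rs)
    len′ : length (deflate a (c ∷ cs)) ≤ length rs
    len′ = subst (_≤ length rs) (sym (length-deflate a c cs)) len

∣+m-+n∣≡∣m-n∣ : ∀ m n → ℤ.∣ + m ℤ.- + n ∣ ≡ ∣ m - n ∣
∣+m-+n∣≡∣m-n∣ m n = trans (cong ℤ.∣_∣ (ℤₚ.[+m]-[+n]≡m⊖n m n)) (∣m⊖n∣≡∣m-n∣ m n)
  where
  ∣m⊖n∣≡∣m-n∣ : ∀ m n → ℤ.∣ m ℤ.⊖ n ∣ ≡ ∣ m - n ∣
  ∣m⊖n∣≡∣m-n∣ zero    zero    = refl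
  ∣m⊖n∣≡∣m-n∣ zero    (suc n) = refl
  ∣m⊖n∣≡∣m-n∣ (suc m) zero    = refl
  ∣m⊖n∣≡∣m-n∣ (suc m) (suc n) =
    trans (cong ℤ.∣_∣ (ℤₚ.[1+m]⊖[1+n]≡m⊖n m n)) (∣m⊖n∣≡∣m-n∣ m n)

≡[mod]⇒≡ : ∀ {p a b} → a < p → b < p → a ≡ b [mod p ] → a ≡ b
≡[mod]⇒≡ {p} {a} {b} a<p b<p p∣a-b =
  ℕₚ.∣m-n∣≡0⇒m≡n (multiple<p⇒≡0 (subst (p ℕᵈ.∣_) (∣+m-+n∣≡∣m-n∣ a b) p∣a-b)
                                 (ℕₚ.≤-<-trans (ℕₚ.∣m-n∣≤m⊔n a b) (ℕₚ.⊔-lub a<p b<p)))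
  where
  multiple<p⇒≡0 : ∀ {n} → p ℕᵈ.∣ n → n < p → n ≡ 0
  multiple<p⇒≡0 {zero}  _   _   = refl
  multiple<p⇒≡0 {suc n} p∣n n<p = contradiction p∣n (ℕᵈ.>⇒∤ n<p)

distinct⇒distinct-mod : ∀ {p xs} → All (_< p) xs → AllPairs _≢_ xs → AllPairs (λ a b → ¬ b ≡ a [mod p ]) xs
distinct⇒distinct-mod []           []                = []
distinct⇒distinct-mod (a<p ∷ as<p) (a≢as ∷ distinct) =
  All.zipWith (λ (b<p , a≢b) b≡a → a≢b (sym (≡[mod]⇒≡ b<p a<p b≡a))) (as<p , a≢as)
  ∷ distinct⇒distinct-mod as<p distinct

-- The polynomial computed by an expression

δ₁ : ℕ → ℕ
δ₁ 1 = 1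
δ₁ _ = 0

coeff : Expr → ℕ → ℕ
coeff x      i       = δ₁ i
coeff (e +x) i       = coeff e i + δ₁ i
coeff (e ·x) zero    = 0
coeff (e ·x) (suc i) = coeff e i

coeff-zero : ∀ e → coeff e 0 ≡ 0
coeff-zero x      = refl
coeff-zero (e +x) = cong (_+ 0) (coeff-zero e)
coeff-zero (e ·x) = refl

coeff≤complexity : ∀ e i → coeff e i ≤ complexity e
coeff≤complexity x      i       = δ₁≤1 i
  where δ₁≤1 : ∀ i → δ₁ i ≤ 1
        δ₁≤1 0       = z≤n
        δ₁≤1 1       = s≤s z≤n
        δ₁≤1 (2+ _) = z≤n
coeff≤complexity (e +x) i       = subst (coeff e i + δ₁ i ≤_) (ℕₚ.+-comm (complexity e) 1)
                                    (ℕₚ.+-mono-≤ (coeff≤complexity e i) (coeff≤complexity x i))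
coeff≤complexity (e ·x) zero    = z≤n
coeff≤complexity (e ·x) (suc i) = ℕₚ.m≤n⇒m≤1+n (coeff≤complexity e i)

coeff-beyond : ∀ e {i} → complexity e < i → coeff e i ≡ 0
coeff-beyond x      {2+ _}       _          = refl
coeff-beyond x      {1}          (s≤s ())
coeff-beyond (e +x) {2+ _}       c<i        = cong (_+ 0) (coeff-beyond e (ℕₚ.<-trans (ℕₚ.n<1+n _) c<i))
coeff-beyond (e +x) {1}          (s≤s ())
coeff-beyond (e ·x) {suc i}      (s≤s c<i)  = coeff-beyond e c<i

coeff≢0 : ∀ e → ∃[ i ] coeff e i ≢ 0
coeff≢0 x      = 1 , λ ()
coeff≢0 (e +x) = let i , cᵢ≢0 = coeff≢0 e in i , cᵢ≢0 ∘ ℕₚ.m+n≡0⇒m≡0 (coeff e i)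
coeff≢0 (e ·x) = let i , cᵢ≢0 = coeff≢0 e in suc i , cᵢ≢0

coeff-injective : ∀ f g → (∀ i → coeff f i ≡ coeff g i) → f ≡ g
coeff-injective x      x      _  = refl
coeff-injective (f +x) (g +x) eq = cong _+x (coeff-injective f g λ i → ℕₚ.+-cancelʳ-≡ _ _ _ (eq i))
coeff-injective (f ·x) (g ·x) eq = cong _·x (coeff-injective f g (eq ∘ suc))
coeff-injective x      (g +x) eq = ⊥-elim (¬coeff-+x≡coeff-x g (sym ∘ eq))
  where
  ¬coeff-+x≡coeff-x : ∀ e → ¬ (∀ i → coeff e i + δ₁ i ≡ δ₁ i)
  ¬coeff-+x≡coeff-x e eq = let i , cᵢ≢0 = coeff≢0 e in cᵢ≢0 (ℕₚ.+-cancelʳ-≡ _ _ 0 (eq i))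
coeff-injective (f +x) x      eq = sym (coeff-injective x (f +x) (sym ∘ eq))
coeff-injective x      (g ·x) eq = contradiction (trans (eq 1) (coeff-zero g)) λ ()
coeff-injective (f ·x) x      eq = sym (coeff-injective x (f ·x) (sym ∘ eq))
coeff-injective (f +x) (g ·x) eq = contradiction (trans (eq 1) (coeff-zero g)) (ℕₚ.m+1+n≢0 (coeff f 1))
coeff-injective (f ·x) (g +x) eq = sym (coeff-injective (g +x) (f ·x) (sym ∘ eq))

horner-applyUpTo-+ : ∀ f g n a → horner (applyUpTo (λ i → f i ℤ.+ g i) n) a
                                  ≡ horner (applyUpTo f n) a ℤ.+ horner (applyUpTo g n) a
horner-applyUpTo-+ f g zero    a = refl
horner-applyUpTo-+ f g (suc n) a rewrite horner-applyUpTo-+ (f ∘ suc) (g ∘ suc) n a =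
  identity (f 0) (g 0) a (horner (applyUpTo (f ∘ suc) n) a) (horner (applyUpTo (g ∘ suc) n) a)
  where identity : ∀ u v a U V → u ℤ.+ v ℤ.+ a ℤ.* (U ℤ.+ V) ≡ u ℤ.+ a ℤ.* U ℤ.+ (v ℤ.+ a ℤ.* V)
        identity = ℤRing.solve-∀

horner-applyUpTo-- : ∀ f g n a → horner (applyUpTo (λ i → f i ℤ.- g i) n) a
                                  ≡ horner (applyUpTo f n) a ℤ.- horner (applyUpTo g n) a
horner-applyUpTo-- f g zero    a = refl
horner-applyUpTo-- f g (suc n) a rewrite horner-applyUpTo-- (f ∘ suc) (g ∘ suc) n a =
  identity (f 0) (g 0) a (horner (applyUpTo (f ∘ suc) n) a) (horner (applyUpTo (g ∘ suc) n) a)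
  where identity : ∀ u v a U V → u ℤ.- v ℤ.+ a ℤ.* (U ℤ.- V) ≡ u ℤ.+ a ℤ.* U ℤ.- (v ℤ.+ a ℤ.* V)
        identity = ℤRing.solve-∀

horner-applyUpTo-0 : ∀ n a → horner (applyUpTo (λ _ → 0ℤ) n) a ≡ 0ℤ
horner-applyUpTo-0 zero    a = refl
horner-applyUpTo-0 (suc n) a rewrite horner-applyUpTo-0 n a = trans (ℤₚ.+-identityˡ _) (ℤₚ.*-zeroʳ a)

coefficients : ℕ → Expr → List ℤ
coefficients n e = applyUpTo (λ i → + coeff e i) n

horner-coefficients-x : ∀ n a → horner (coefficients (2+ n) x) a ≡ a
horner-coefficients-x n a rewrite horner-applyUpTo-0 n a = identity a
  where identity : ∀ a → 0ℤ ℤ.+ a ℤ.* (+ 1 ℤ.+ a ℤ.* 0ℤ) ≡ a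
        identity = ℤRing.solve-∀

horner-coefficients : ∀ e {n} s → complexity e < n → horner (coefficients n e) (+ s) ≡ + eval s e
horner-coefficients x      {2+ n}  s _          = horner-coefficients-x n (+ s)
horner-coefficients x      {1}     s (s≤s ())
horner-coefficients (e +x) {2+ n}  s c<n        =
  trans (horner-applyUpTo-+ (λ i → + coeff e i) (λ i → + δ₁ i) (2+ n) (+ s))
        (cong₂ ℤ._+_ (horner-coefficients e s (ℕₚ.<-trans (ℕₚ.n<1+n _) c<n)) (horner-coefficients-x n (+ s)))
horner-coefficients (e +x) {1}     s (s≤s ())
horner-coefficients (e ·x) {suc n} s (s≤s c<n) rewrite horner-coefficients e s c<n =
  trans (ℤₚ.+-identityˡ _) (trans (ℤₚ.*-comm (+ s) (+ eval s e)) (sym (ℤₚ.pos-* (eval s e) s)))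

difference : ℕ → Expr → Expr → List ℤ
difference n f g = applyUpTo (λ i → + coeff f i ℤ.- + coeff g i) n

horner-difference : ∀ {n} f g s → complexity f < n → complexity g < n →
                    horner (difference n f g) (+ s) ≡ + eval s f ℤ.- + eval s g
horner-difference {n} f g s f<n g<n =
  trans (horner-applyUpTo-- (λ i → + coeff f i) (λ i → + coeff g i) n (+ s))
        (cong₂ ℤ._-_ (horner-coefficients f s f<n) (horner-coefficients g s g<n))

difference-∣⇒≡ : ∀ {p n f g} → complexity f < n → complexity g < n → n ≤ p →
                 All (+ p ∣_) (difference n f g) → f ≡ g
difference-∣⇒≡ {p} {n} {f} {g} f<n g<n n≤p p∣difference = coeff-injective f g same
  where
  coeff<p : ∀ e i → complexity e < n → coeff e i < p
  coeff<p e i e<n = ℕₚ.<-≤-trans (ℕₚ.≤-<-trans (coeff≤complexity e i) e<n) n≤p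
  same : ∀ i → coeff f i ≡ coeff g i
  same i with i ℕₚ.<? n
  ... | yes i<n = ≡[mod]⇒≡ (coeff<p f i f<n) (coeff<p g i g<n)
                           (All.lookup p∣difference (∈-applyUpTo⁺ _ i<n))
  ... | no  i≮n = trans (coeff-beyond f (ℕₚ.<-≤-trans f<n (ℕₚ.≮⇒≥ i≮n)))
                        (sym (coeff-beyond g (ℕₚ.<-≤-trans g<n (ℕₚ.≮⇒≥ i≮n))))

agreeing-on-residues⇒≡ : ∀ {p k f g} → Prime p → k < p → complexity f ≤ k → complexity g ≤ k →
                         ∀ rs → Unique rs → All (_< p) rs → All (λ r → eval r f ≡ eval r g [mod p ]) rs →
                         suc k ≤ length rs → f ≡ g
agreeing-on-residues⇒≡ {p} {k} {f} {g} pr k<p f≤k g≤k rs unique rs<p agree k<|rs| =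
  difference-∣⇒≡ (s≤s f≤k) (s≤s g≤k) k<p
    (roots⇒∣-coefficients pr (difference (suc k) f g) (map +_ rs)
      (AllPairs.map⁺ (distinct⇒distinct-mod rs<p unique))
      (All.map⁺ (All.map (λ {r} → subst (+ p ∣_) (sym (horner-difference f g r (s≤s f≤k) (s≤s g≤k))))
                         agree))
      (subst₂ _≤_ (sym (length-applyUpTo (λ i → + coeff f i ℤ.- + coeff g i) (suc k)))
                  (sym (length-map +_ rs)) k<|rs|))

_≟_ : DecidableEquality Expr
x      ≟ x      = yes refl
(f +x) ≟ (g +x) = map′ (cong _+x) (λ { refl → refl }) (f ≟ g)
(f ·x) ≟ (g ·x) = map′ (cong _·x) (λ { refl → refl }) (f ≟ g)
x      ≟ (_ +x) = no λ ()
x      ≟ (_ ·x) = no λ ()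
(_ +x) ≟ x      = no λ ()
(_ +x) ≟ (_ ·x) = no λ ()
(_ ·x) ≟ x      = no λ ()
(_ ·x) ≟ (_ +x) = no λ ()

CollidingPair : ℕ → Expr × Expr → ℕ → Set
CollidingPair p (f , g) s = f ≢ g × eval s f ≡ eval s g [mod p ]

collidingPair? : ∀ p π → Decidable (CollidingPair p π)
collidingPair? p (f , g) s = ¬? (f ≟ g) ×-dec (p ℕᵈ.∣? ℤ.∣ + eval s f ℤ.- + eval s g ∣)

eval-0 : ∀ e → eval 0 e ≡ 0
eval-0 x      = refl
eval-0 (e +x) = cong (_+ 0) (eval-0 e)
eval-0 (e ·x) = cong (_* 0) (eval-0 e)

-- The constant term of every expression vanishes, so 0 is one more common root.
collisions≤ : ∀ {p n f g} → Prime p → suc n < p → complexity f ≤ suc n → complexity g ≤ suc n →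
              ∀ {S} → Unique S → All (λ s → 0 < s × s < p) S →
              length (filter (collidingPair? p (f , g)) S) ≤ n
collisions≤ {p} {n} {f} {g} pr n+1<p f≤ g≤ {S} unique bounded = ℕₚ.≮⇒≥ λ n<|R| →
  distinct (All.all-filter P? S) n<|R|
    (agreeing-on-residues⇒≡ pr n+1<p f≤ g≤ (0 ∷ R)
      (All.map (λ (0<s , _) → ℕₚ.<⇒≢ 0<s) (All.filter⁺ P? bounded) ∷ AllPairs.filter⁺ P? unique)
      (ℕₚ.≤-<-trans z≤n n+1<p ∷ All.map proj₂ (All.filter⁺ P? bounded))
      (agree-at-0 ∷ All.map proj₂ (All.all-filter P? S))
      (s≤s n<|R|))
  where
  P? : Decidable (CollidingPair p (f , g))
  P? = collidingPair? p (f , g)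
  R : List ℕ
  R = filter P? S
  agree-at-0 : eval 0 f ≡ eval 0 g [mod p ]
  agree-at-0 = subst₂ (λ a b → a ≡ b [mod p ]) (sym (eval-0 f)) (sym (eval-0 g)) (p ℕᵈ.∣0)
  distinct : ∀ {rs} → All (CollidingPair p (f , g)) rs → n < length rs → f ≢ g
  distinct (collision ∷ _) _ = proj₁ collision

expressions : ℕ → List Expr
expressions zero    = []
expressions (suc k) = x ∷ map _+x (expressions k) ++ map _·x (expressions k)

expressions-bounded : ∀ k → All (λ e → complexity e ≤ k) (expressions k)
expressions-bounded zero    = []
expressions-bounded (suc k) =
  s≤s z≤n ∷ All.++⁺ (All.map⁺ bounded) (All.map⁺ bounded)
  where bounded : All (λ e → complexity e < suc k) (expressions k)
        bounded = All.map s≤s (expressions-bounded k)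

∈-expressions : ∀ {e k} → complexity e ≤ k → e ∈ expressions k
∈-expressions {x}    {suc k} _         = here refl
∈-expressions {e +x} {suc k} (s≤s e≤k) = there (∈-++⁺ˡ (∈-map⁺ _+x (∈-expressions e≤k)))
∈-expressions {e ·x} {suc k} (s≤s e≤k) =
  there (∈-++⁺ʳ (map _+x (expressions k)) (∈-map⁺ _·x (∈-expressions e≤k)))

length-expressions : ∀ k → suc (length (expressions k)) ≡ 2 ^ k
length-expressions zero    = refl
length-expressions (suc k) = begin
  suc (suc (length (map _+x E ++ map _·x E)))
    ≡⟨ cong (suc ∘ suc) (length-++ (map _+x E)) ⟩
  suc (suc (length (map _+x E) + length (map _·x E)))
    ≡⟨ cong₂ (λ a b → suc (suc (a + b))) (length-map _+x E) (length-map _·x E) ⟩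
  suc (suc (length E + length E))
    ≡⟨ cong suc (ℕₚ.+-suc (length E) (length E)) ⟨
  suc (length E) + suc (length E)
    ≡⟨ cong₂ _+_ (length-expressions k) (trans (length-expressions k) (sym (ℕₚ.+-identityʳ _))) ⟩
  2 ^ suc k
    ∎
  where
  open ≡-Reasoning
  E : List Expr
  E = expressions k

length-cartesianProduct : ∀ {A B : Set} (as : List A) (bs : List B) →
                          length (cartesianProduct as bs) ≡ length as * length bs
length-cartesianProduct []       bs = refl
length-cartesianProduct (a ∷ as) bs =
  trans (length-++ (map (a ,_) bs)) (cong₂ _+_ (length-map (a ,_) bs) (length-cartesianProduct as bs))

pairs : ℕ → List (Expr × Expr)
pairs k = cartesianProduct (expressions k) (expressions k)

Collides⇒Any : ∀ {p s k} → Collides p s k → Any (λ π → CollidingPair p π s) (pairs k)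
Collides⇒Any (f , g , f≢g , f≤k , g≤k , fs≡gs) =
  lose (∈-cartesianProduct⁺ (∈-expressions f≤k) (∈-expressions g≤k)) (f≢g , fs≡gs)

Any⇒Collides : ∀ {p s k} → Any (λ π → CollidingPair p π s) (pairs k) → Collides p s k
Any⇒Collides {k = k} collision =
  let (f , g) , fg∈ , f≢g , fs≡gs = find collision
      f∈ , g∈ = ∈-cartesianProduct⁻ (expressions k) (expressions k) fg∈
  in f , g , f≢g , All.lookup (expressions-bounded k) f∈ , All.lookup (expressions-bounded k) g∈ , fs≡gs

collides? : ∀ p s k → Dec (Collides p s k)
collides? p s k = map′ Any⇒Collides Collides⇒Any (any? (λ π → collidingPair? p π s) (pairs k))

Collides-mono : ∀ {p s j k} → j ≤ k → Collides p s j → Collides p s k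
Collides-mono j≤k (f , g , f≢g , f≤j , g≤j , fs≡gs) =
  f , g , f≢g , ℕₚ.≤-trans f≤j j≤k , ℕₚ.≤-trans g≤j j≤k , fs≡gs

¬Collides-0 : ∀ {p s} → ¬ Collides p s 0
¬Collides-0 (x    , _ , _ , () , _)
¬Collides-0 (_ +x , _ , _ , () , _)
¬Collides-0 (_ ·x , _ , _ , () , _)

multiple : ℕ → Expr
multiple zero    = x
multiple (suc n) = multiple n +x

complexity-multiple : ∀ n → complexity (multiple n) ≡ suc n
complexity-multiple zero    = refl
complexity-multiple (suc n) = cong suc (complexity-multiple n)

eval-multiple : ∀ s n → eval s (multiple n) ≡ s + n * s
eval-multiple s zero    = sym (ℕₚ.+-identityʳ s)
eval-multiple s (suc n) = trans (cong (_+ s) (eval-multiple s n)) (identity s n)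
  where identity : ∀ s n → s + n * s + s ≡ s + (s + n * s)
        identity = ℕRing.solve-∀

≡[mod]-+-multiple : ∀ p a b → a ≡ a + p * b [mod p ]
≡[mod]-+-multiple p a b =
  subst (p ℕᵈ.∣_) (sym (trans (∣+m-+n∣≡∣m-n∣ a (a + p * b)) (ℕₚ.∣m-m+n∣≡n a (p * b)))) (ℕᵈ.m∣m*n b)

Collides-at-p+1 : ∀ p s → 0 < p → Collides p s (suc p)
Collides-at-p+1 (suc q) s _ =
  x , multiple (suc q) , (λ ()) , s≤s z≤n , ℕₚ.≤-reflexive (complexity-multiple (suc q)) ,
  subst (λ n → s ≡ n [mod suc q ]) (sym (eval-multiple s (suc q))) (≡[mod]-+-multiple (suc q) s s)

least : ∀ {P : ℕ → Set} → Decidable P → ∀ n → P n → ∃[ r ] P r × (∀ k → k < r → ¬ P k)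
least P? zero    P0 = 0 , P0 , λ _ ()
least P? (suc n) Pn with P? 0
... | yes P0 = 0 , P0 , λ _ ()
... | no ¬P0 = let r , Pr , below = least (P? ∘ suc) n Pn in
  suc r , Pr , λ { zero _ → ¬P0 ; (suc k) k<r → below k (s<s⁻¹ k<r) }

resilience-exists : ∀ p s → 0 < p → ∃[ r ] IsResilience p s r
resilience-exists p s 0<p =
  let r , collides , below = least (collides? p s) (suc p) (Collides-at-p+1 p s 0<p) in
  r , ℕₚ.n≢0⇒n>0 (λ r≡0 → ¬Collides-0 (subst (Collides p s) r≡0 collides)) , collides , λ k _ → below k

resilience> : ∀ {p s r k} → IsResilience p s r → ¬ Collides p s k → k < r
resilience> (_ , collides , _) ¬collides = ℕₚ.≰⇒> λ r≤k → ¬collides (Collides-mono r≤k collides)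

-- Counting

sum-map-≤ : ∀ {A : Set} {f g : A → ℕ} as → (∀ a → f a ≤ g a) → sum (map f as) ≤ sum (map g as)
sum-map-≤ []       _   = z≤n
sum-map-≤ (a ∷ as) f≤g = ℕₚ.+-mono-≤ (f≤g a) (sum-map-≤ as f≤g)

sum-map-< : ∀ {A : Set} {f g : A → ℕ} {as} → (∀ a → f a ≤ g a) → Any (λ a → f a < g a) as →
            sum (map f as) < sum (map g as)
sum-map-< {as = a ∷ as} f≤g (here fa<ga) = ℕₚ.+-mono-<-≤ fa<ga (sum-map-≤ as f≤g)
sum-map-< {as = a ∷ as} f≤g (there lt)   = ℕₚ.+-mono-≤-< (f≤g a) (sum-map-< f≤g lt)

sum-map-≤-* : ∀ {A : Set} {f : A → ℕ} {B} as → All (λ a → f a ≤ B) as → sum (map f as) ≤ length as * B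
sum-map-≤-* []       []          = z≤n
sum-map-≤-* (a ∷ as) (fa≤B ∷ bs) = ℕₚ.+-mono-≤ fa≤B (sum-map-≤-* as bs)

length-filter-∷ : ∀ {A : Set} {P : A → Set} (P? : Decidable P) y ys →
                  length (filter P? ys) ≤ length (filter P? (y ∷ ys))
length-filter-∷ P? y ys with does (P? y)
... | true  = ℕₚ.n≤1+n _
... | false = ℕₚ.≤-refl

module _ {A B : Set} {Q : A → B → Set} (Q? : ∀ a → Decidable (Q a)) where

  hits : List A → List B → ℕ
  hits as bs = sum (map (λ a → length (filter (Q? a) bs)) as)

  hits-∷ : ∀ as b bs → Any (λ a → Q a b) as → hits as bs < hits as (b ∷ bs)
  hits-∷ as b bs hit =
    sum-map-< (λ a → length-filter-∷ (Q? a) b bs)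
              (Any.map (λ {a} Qab → ℕₚ.≤-reflexive (cong length (sym (filter-accept (Q? a) Qab)))) hit)

  uncovered : ∀ as bs → hits as bs < length bs → ∃[ b ] b ∈ bs × All (λ a → ¬ Q a b) as
  uncovered as []       ()
  uncovered as (b ∷ bs) h with any? (λ a → Q? a b) as
  ... | no ¬hit = b , here refl , All.¬Any⇒All¬ as ¬hit
  ... | yes hit =
    let b′ , b′∈bs , misses = uncovered as bs (ℕₚ.≤-trans (hits-∷ as b bs hit) (s≤s⁻¹ h))
    in b′ , there b′∈bs , misses

∃-nonColliding : ∀ {p n} → Prime p → 2 ^ suc n * 2 ^ suc n * n + 2 ≤ p →
                 ∃[ s ] 0 < s × s < p × ¬ Collides p s (suc n)
∃-nonColliding {zero}  _  h = ⊥-elim (ℕₚ.n≮0 (ℕₚ.≤-trans (ℕₚ.m≤n+m 2 _) h))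
∃-nonColliding {suc q} {n} pr h =
  let s , s∈S , misses = uncovered (collidingPair? (suc q)) (pairs (suc n)) S hits<|S|
      0<s , s<p = All.lookup S-bounded s∈S
  in s , 0<s , s<p , All.All¬⇒¬Any misses ∘ Collides⇒Any
  where
  t : ℕ
  t = 2 ^ suc n
  E : List Expr
  E = expressions (suc n)
  S : List ℕ
  S = applyUpTo suc q
  S-unique : Unique S
  S-unique = Unique.applyUpTo⁺₁ suc q (λ i<j _ → ℕₚ.<⇒≢ (s≤s i<j))
  S-bounded : All (λ s → 0 < s × s < suc q) S
  S-bounded = All.applyUpTo⁺₁ suc q (λ i<q → s≤s z≤n , s≤s i<q)
  ttn<q : t * t * n < q
  ttn<q = s≤s⁻¹ (subst (_≤ suc q) (ℕₚ.+-comm _ 2) h)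
  n+1<p : suc n < suc q
  n+1<p = ℕₚ.≤-trans (s≤s (s≤s (ℕₚ.m≤n*m n (t * t) {{t*t≢0}}))) (s≤s ttn<q)
    where t*t≢0 : ℕ.NonZero (t * t)
          t*t≢0 = ℕₚ.m*n≢0 t t {{ℕₚ.m^n≢0 2 (suc n)}} {{ℕₚ.m^n≢0 2 (suc n)}}
  |E|<t : length E < t
  |E|<t = ℕₚ.≤-reflexive (length-expressions (suc n))
  |pairs|≤t*t : length (pairs (suc n)) ≤ t * t
  |pairs|≤t*t = subst (_≤ t * t) (sym (length-cartesianProduct E E))
                      (ℕₚ.*-mono-≤ (ℕₚ.<⇒≤ |E|<t) (ℕₚ.<⇒≤ |E|<t))
  collisions-per-pair : ∀ {π} → π ∈ pairs (suc n) → length (filter (collidingPair? (suc q) π) S) ≤ n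
  collisions-per-pair {f , g} fg∈ =
    let f∈ , g∈ = ∈-cartesianProduct⁻ E E fg∈ in
    collisions≤ pr n+1<p (All.lookup (expressions-bounded (suc n)) f∈)
                         (All.lookup (expressions-bounded (suc n)) g∈) S-unique S-bounded
  hits<|S| : hits (collidingPair? (suc q)) (pairs (suc n)) S < length S
  hits<|S| = ℕₚ.≤-<-trans (sum-map-≤-* (pairs (suc n)) (All.tabulate collisions-per-pair))
               (ℕₚ.≤-<-trans (ℕₚ.*-monoˡ-≤ n |pairs|≤t*t)
                 (subst (t * t * n <_) (sym (length-applyUpTo suc q)) ttn<q))

-- The numerical condition

4^n≡2^n*2^n : ∀ n → 4 ^ n ≡ 2 ^ n * 2 ^ n
4^n≡2^n*2^n zero    = refl
4^n≡2^n*2^n (suc n) = trans (cong (4 *_) (4^n≡2^n*2^n n)) (identity (2 ^ n))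
  where identity : ∀ a → 4 * (a * a) ≡ 2 * a * (2 * a)
        identity = ℕRing.solve-∀

Bound⇒ℕ : ∀ {p m} → Bound p (3 + m) → suc m * 4 ^ (3 + m) + 2 ^ (3 + m) ≤ 2 * p + m * 2 ^ (3 + m)
Bound⇒ℕ {p} {m} bound = ℤₚ.drop‿+≤+ (begin
  + (suc m * A + B)          ≡⟨ cong (ℤ._+ + B) (ℤₚ.pos-* (suc m) A) ⟩
  + suc m ℤ.* + A ℤ.+ + B    ≡⟨ identity (+ m) (+ A) (+ B) ⟩
  lhs ℤ.+ + m ℤ.* + B        ≡⟨ cong (λ z → lhs ℤ.+ z) (ℤₚ.pos-* m B) ⟨
  lhs ℤ.+ + (m * B)          ≤⟨ ℤₚ.+-monoˡ-≤ (+ (m * B)) bound ⟩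
  + (2 * p + m * B)          ∎)
  where
  open ℤₚ.≤-Reasoning
  A B : ℕ
  A = 4 ^ (3 + m)
  B = 2 ^ (3 + m)
  lhs : ℤ
  lhs = (+ (3 + m) ℤ.- + 2) ℤ.* + A ℤ.- (+ (3 + m) ℤ.- + 4) ℤ.* + B
  identity : ∀ M A B → (+ 1 ℤ.+ M) ℤ.* A ℤ.+ B
                       ≡ ((+ 3 ℤ.+ M) ℤ.- + 2) ℤ.* A ℤ.- ((+ 3 ℤ.+ M) ℤ.- + 4) ℤ.* B ℤ.+ M ℤ.* B
  identity = ℤRing.solve-∀

square-bound : ∀ m t p → 2 ≤ t → suc m * (4 * (t * t)) + 2 * t ≤ 2 * p + m * (2 * t) →
               t * t * suc m + 2 ≤ p
square-bound m 1      p (s≤s ()) _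
square-bound m (2+ u) p _ h = ℕₚ.*-cancelˡ-≤ 2 (ℕₚ.+-cancelʳ-≤ (m * (2 * t)) _ _ (begin
  2 * (t * t * suc m + 2) + m * (2 * t)      ≤⟨ ℕₚ.m≤m+n _ slack ⟩
  2 * (t * t * suc m + 2) + m * (2 * t) + slack ≡⟨ identity m u ⟩
  suc m * (4 * (t * t)) + 2 * t               ≤⟨ h ⟩
  2 * p + m * (2 * t)                         ∎))
  where
  open ℕₚ.≤-Reasoning
  t slack : ℕ
  t = 2+ u
  -- writing t = u + 2 makes the slack a polynomial with nonnegative coefficients
  slack = 2 * suc m * (u * u) + (6 * m + 10) * u + 4 * m + 8
  identity : ∀ m u → 2 * ((2+ u) * (2+ u) * suc m + 2) + m * (2 * (2+ u))
                       + (2 * suc m * (u * u) + (6 * m + 10) * u + 4 * m + 8)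
                     ≡ suc m * (4 * ((2+ u) * (2+ u))) + 2 * (2+ u)
  identity = ℕRing.solve-∀

Bound⇒square-bound : ∀ {p m} → Bound p (3 + m) → 2 ^ (2 + m) * 2 ^ (2 + m) * suc m + 2 ≤ p
Bound⇒square-bound {p} {m} bound =
  square-bound m (2 ^ (2 + m)) p (ℕₚ.^-monoʳ-≤ 2 {1} {2 + m} (s≤s z≤n))
    (subst (λ A → suc m * A + 2 ^ (3 + m) ≤ 2 * p + m * 2 ^ (3 + m))
           (cong (4 *_) (4^n≡2^n*2^n (2 + m))) (Bound⇒ℕ {p} {m} bound))

Bound⇒∃-nonColliding : ∀ {p k} → Prime p → Bound p (suc k) → ∃[ s ] 0 < s × s < p × ¬ Collides p s k
Bound⇒∃-nonColliding {p} {zero} pr _     = 1 , s≤s z≤n , 1<p , ¬Collides-0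
  where 1<p : 1 < p
        1<p = ℕ.nonTrivial⇒n>1 p {{prime⇒nonTrivial pr}}
-- for k = 1 the counting hypothesis reduces to 2 ≤ p
Bound⇒∃-nonColliding {p} {1}    pr _     = ∃-nonColliding {n = 0} pr (ℕ.nonTrivial⇒n>1 p {{prime⇒nonTrivial pr}})
Bound⇒∃-nonColliding {p} {2+ m} pr bound = ∃-nonColliding pr (Bound⇒square-bound {p} {m} bound)

lemma4p7 : (p : ℕ) → Prime p → (K : ℕ) → IsLargestBound p K →
    Σ ℕ λ s → 0 < s × s < p × Σ ℕ λ r → IsResilience p s r × K ≤ r
lemma4p7 p pr zero    (() , _)
lemma4p7 p pr (suc k) (_ , bound , _) =
  let s , 0<s , s<p , ¬collides = Bound⇒∃-nonColliding pr bound
      r , resilience = resilience-exists p s (ℕₚ.<-trans 0<s s<p)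
  in s , 0<s , s<p , r , resilience , resilience> resilience ¬collides
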